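{- Let $\varepsilon>0$, let $k,t$ be positive integers, and let $H$ be a graph whose vertex set is partitioned as $V(H)=A_{1}\cup A_{2}\cup B_{1}\cup\dots\cup B_{k}$ with $|A_{1}|=|A_{2}|=|B_{1}|=\dots=|B_{k}|=t$. Let $d_{ij}\ge 0$ ($i\in[2]$, $j\in[k]$) be reals. Suppose that for every $i\in[2]$, $j\in[k]$ the pair $(A_{i},B_{j})$ is $\varepsilon$-uniform and $e(A_{i},B_{j})\geq d_{ij}t^{2}$. If $e(A_{1},A_{2})>0$, then there is an edge $uv$ with $u\in A_1$, $v\in A_2$ such that the number of common neighbours of $u$ and $v$ in $H$ is at least \[ t\left(1-\frac{2\varepsilon t^{2}}{e(A_{1},A_{2})}\right)\left(\sum_{i=1}^{k}d_{1i}d_{2i}\right)-2\varepsilon kt. \]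
   Context: For disjoint vertex sets $X,Y$, $e(X,Y)$ is the number of edges with one endpoint in $X$ and one in $Y$, and $d(X,Y)=e(X,Y)/(|X||Y|)$. A pair $(A,B)$ of disjoint nonempty vertex sets is $\varepsilon$-uniform if for all $X\subseteq A$, $Y\subseteq B$ with $|X|\ge\varepsilon|A|$, $|Y|\ge\varepsilon|B|$ one has $|d(X,Y)-d(A,B)|<\varepsilon$. A book with base $uv$ of size $s$ means an edge $uv$ together with $s$ common neighbours of $u$ and $v$.
   Formalization: The parameter ε and the numbers $d_{ij}$ are taken over the rationals rather than the reals. -}

module Defs where

open import Data.Nat as ℕ using (ℕ; zero; suc)
open import Data.Integer using (+_)
open import Data.Fin using (Fin; zero; suc)
open import Data.Bool using (Bool; true; false; _∧_; if_then_else_)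
open import Data.Product using (_×_; _,_)
open import Data.Rational as ℚ using (ℚ; 0ℚ; _/_)
open import Relation.Binary.PropositionalEquality using (_≡_)

ℕ→ℚ : ℕ → ℚ
ℕ→ℚ n = + n / 1

-- a / b as a rational, with the convention a / 0 = 0 (only used with b > 0).
frac : ℕ → ℕ → ℚ
frac a zero = 0ℚ
frac a (suc b) = + a / suc b

count : ∀ {m} → (Fin m → Bool) → ℕ
count {zero} P = 0
count {suc m} P = (if P zero then 1 else 0) ℕ.+ count (λ i → P (suc i))

record SimpleGraph (V : Set) : Set where
  field
    adj    : V → V → Bool
    sym    : ∀ u v → adj u v ≡ adj v u
    irrefl : ∀ v → adj v v ≡ false
open SimpleGraph public

-- Vertex set partitioned into m parts of size t:  vertex (p , a) is the
-- a-th vertex of part p.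
Vtx : ℕ → ℕ → Set
Vtx m t = Fin m × Fin t

Sub : ℕ → Set
Sub t = Fin t → Bool

full : ∀ {t} → Sub t
full _ = true

sumFin : ∀ {m} → (Fin m → ℕ) → ℕ
sumFin {zero} f = 0
sumFin {suc m} f = f zero ℕ.+ sumFin (λ i → f (suc i))

eSub : ∀ {m t} → SimpleGraph (Vtx m t) → Fin m → Fin m → Sub t → Sub t → ℕ
eSub H p q X Y = sumFin (λ a → count (λ b → X a ∧ Y b ∧ adj H (p , a) (q , b)))

dens : ∀ {m t} → SimpleGraph (Vtx m t) → Fin m → Fin m → Sub t → Sub t → ℚ
dens H p q X Y = frac (eSub H p q X Y) (count X ℕ.* count Y)

Uniform : ∀ {m t} → ℚ → SimpleGraph (Vtx m t) → Fin m → Fin m → Set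
Uniform {t = t} ε H p q =
  ∀ (X Y : Sub t) → ε ℚ.* ℕ→ℚ t ℚ.≤ ℕ→ℚ (count X) → ε ℚ.* ℕ→ℚ t ℚ.≤ ℕ→ℚ (count Y) →
  ℚ.∣ dens H p q X Y ℚ.- dens H p q full full ∣ ℚ.< ε

commonNbrs : ∀ {m t} → SimpleGraph (Vtx m t) → Vtx m t → Vtx m t → ℕ
commonNbrs H u v = sumFin (λ p → count (λ a → adj H u (p , a) ∧ adj H v (p , a)))

sumℚ : ∀ {m} → (Fin m → ℚ) → ℚ
sumℚ {zero} f = 0ℚ
sumℚ {suc m} f = f zero ℚ.+ sumℚ (λ i → f (suc i))

{-# OPTIONS --safe #-}
-- For each part B_j with d₁ⱼ, d₂ⱼ ≥ 2ε, ε-uniformity of (A₁, B_j) leaves fewer than εt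
-- vertices u ∈ A₁ with fewer than (d₁ⱼ - ε)t neighbours in B_j.  For every other u the set
-- N = N(u) ∩ B_j has at least εt elements, so ε-uniformity of (A₂, B_j) leaves fewer than εt
-- vertices v ∈ A₂ with fewer than (d₂ⱼ - ε)|N| neighbours in N.  Hence all but 2εt² pairs
-- (u, v) ∈ A₁ × A₂ have at least (d₁ⱼ - ε)(d₂ⱼ - ε)t common neighbours in B_j, and summing
-- over the e(A₁, A₂) edges gives at least (d₁ⱼ - ε)(d₂ⱼ - ε)t (e(A₁, A₂) - 2εt²) of them,
-- which dominates e(A₁, A₂) times the j-th summand of the bound.  If d₁ⱼ < 2ε or d₂ⱼ < 2ε
-- that summand is not positive.  Summing over j and averaging over the edges of (A₁, A₂)
-- gives the edge uv.
module Submission where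

module BookCounting where

  open import Defs hiding (sym)
  open import Data.Nat as ℕ using (ℕ; zero; suc)
  import Data.Nat.Properties as ℕ
  import Data.Integer as ℤ
  import Data.Integer.Properties as ℤ
  open import Data.Fin using (Fin; zero; suc; _↑ʳ_)
  open import Data.Fin.Properties using (any?)
  import Data.Bool as Bool
  open import Data.Bool using (Bool; true; false; _∧_; _∨_; if_then_else_)
  open import Data.Bool.Properties using (∨-conicalˡ; ∨-conicalʳ; T-≡; T-not-≡)
  open import Data.Empty using (⊥-elim)
  open import Data.Product using (∃; _×_; _,_)
  open import Data.Sum using (_⊎_; inj₁; inj₂)
  open import Data.Rational using (ℚ; 0ℚ; 1ℚ; _≤_; _<_; _+_; _-_; _*_; -_; ∣_∣; toℚᵘ; nonNegative; positive)
  open import Data.Rational.Properties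
  import Data.Rational.Unnormalised as ℚᵘ
  import Data.Rational.Unnormalised.Properties as ℚᵘ
  open import Function.Bundles using (Equivalence)
  open import Relation.Binary.PropositionalEquality
  open import Relation.Nullary using (Dec; yes; no)
  open import Relation.Nullary.Decidable using (_×-dec_; isYes; toWitness; toWitnessFalse; decidable-stable; dec⇒maybe)
  open import Tactic.RingSolver using (solve-∀)
  open import Tactic.RingSolver.Core.AlmostCommutativeRing using (AlmostCommutativeRing; fromCommutativeRing)

  ℚ-ring : AlmostCommutativeRing _ _
  ℚ-ring = fromCommutativeRing +-*-commutativeRing (λ x → dec⇒maybe (0ℚ ≟ x))

  ≤-by-gap : ∀ {p q} r → q ≡ p + r → 0ℚ ≤ r → p ≤ q
  ≤-by-gap {p} r refl 0≤r = subst (_≤ p + r) (+-identityʳ p) (+-monoʳ-≤ p 0≤r)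

  p≤q⇒0≤q-p : ∀ {p q} → p ≤ q → 0ℚ ≤ q - p
  p≤q⇒0≤q-p {p} {q} p≤q = subst (_≤ q - p) (+-inverseʳ p) (+-monoˡ-≤ (- p) p≤q)

  +-nonNeg : ∀ {p q} → 0ℚ ≤ p → 0ℚ ≤ q → 0ℚ ≤ p + q
  +-nonNeg = +-mono-≤

  *-nonNeg : ∀ {p q} → 0ℚ ≤ p → 0ℚ ≤ q → 0ℚ ≤ p * q
  *-nonNeg {p} {q} 0≤p 0≤q =
    nonNegative⁻¹ _ {{nonNeg*nonNeg⇒nonNeg p {{nonNegative 0≤p}} q {{nonNegative 0≤q}}}}

  *-pos : ∀ {p q} → 0ℚ < p → 0ℚ < q → 0ℚ < p * q
  *-pos {p} {q} 0<p 0<q = positive⁻¹ _ {{pos*pos⇒pos p {{positive 0<p}} q {{positive 0<q}}}}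

  toℚᵘ-ℕ→ℚ : ∀ n → toℚᵘ (ℕ→ℚ n) ℚᵘ.≃ ℚᵘ.mkℚᵘ (ℤ.+ n) 0
  toℚᵘ-ℕ→ℚ n = toℚᵘ-fromℚᵘ (ℚᵘ.mkℚᵘ (ℤ.+ n) 0)

  ℕ→ℚ-+ : ∀ m n → ℕ→ℚ (m ℕ.+ n) ≡ ℕ→ℚ m + ℕ→ℚ n
  ℕ→ℚ-+ m n = toℚᵘ-injective (begin
    toℚᵘ (ℕ→ℚ (m ℕ.+ n))
      ≈⟨ toℚᵘ-ℕ→ℚ (m ℕ.+ n) ⟩
    ℚᵘ.mkℚᵘ (ℤ.+ (m ℕ.+ n)) 0
      ≈⟨ ℚᵘ.*≡* (cong (ℤ._* ℤ.+ 1) (sym (cong₂ ℤ._+_ (ℤ.*-identityʳ (ℤ.+ m)) (ℤ.*-identityʳ (ℤ.+ n))))) ⟩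
    ℚᵘ.mkℚᵘ (ℤ.+ m) 0 ℚᵘ.+ ℚᵘ.mkℚᵘ (ℤ.+ n) 0
      ≈⟨ ℚᵘ.+-cong (toℚᵘ-ℕ→ℚ m) (toℚᵘ-ℕ→ℚ n) ⟨
    toℚᵘ (ℕ→ℚ m) ℚᵘ.+ toℚᵘ (ℕ→ℚ n)
      ≈⟨ toℚᵘ-homo-+ (ℕ→ℚ m) (ℕ→ℚ n) ⟨
    toℚᵘ (ℕ→ℚ m + ℕ→ℚ n) ∎)
    where open ℚᵘ.≃-Reasoning

  ℕ→ℚ-* : ∀ m n → ℕ→ℚ (m ℕ.* n) ≡ ℕ→ℚ m * ℕ→ℚ n
  ℕ→ℚ-* m n = toℚᵘ-injective (begin
    toℚᵘ (ℕ→ℚ (m ℕ.* n))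
      ≈⟨ toℚᵘ-ℕ→ℚ (m ℕ.* n) ⟩
    ℚᵘ.mkℚᵘ (ℤ.+ (m ℕ.* n)) 0
      ≈⟨ ℚᵘ.*≡* (cong (ℤ._* ℤ.+ 1) (ℤ.pos-* m n)) ⟩
    ℚᵘ.mkℚᵘ (ℤ.+ m) 0 ℚᵘ.* ℚᵘ.mkℚᵘ (ℤ.+ n) 0
      ≈⟨ ℚᵘ.*-cong (toℚᵘ-ℕ→ℚ m) (toℚᵘ-ℕ→ℚ n) ⟨
    toℚᵘ (ℕ→ℚ m) ℚᵘ.* toℚᵘ (ℕ→ℚ n)
      ≈⟨ toℚᵘ-homo-* (ℕ→ℚ m) (ℕ→ℚ n) ⟨
    toℚᵘ (ℕ→ℚ m * ℕ→ℚ n) ∎)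
    where open ℚᵘ.≃-Reasoning

  0≤ℕ→ℚ : ∀ n → 0ℚ ≤ ℕ→ℚ n
  0≤ℕ→ℚ n = nonNegative⁻¹ _ {{normalize-nonNeg n 1}}

  ℕ→ℚ-pos : ∀ n .{{_ : ℕ.NonZero n}} → 0ℚ < ℕ→ℚ n
  ℕ→ℚ-pos (suc n) = positive⁻¹ _ {{normalize-pos (suc n) 1}}

  ℕ→ℚ-pos⁻¹ : ∀ {n} → 0ℚ < ℕ→ℚ n → ℕ.NonZero n
  ℕ→ℚ-pos⁻¹ {zero}  0<0 = ⊥-elim (<-irrefl refl 0<0)
  ℕ→ℚ-pos⁻¹ {suc n} _   = _

  ℕ→ℚ-mono-≤ : ∀ {m n} → m ℕ.≤ n → ℕ→ℚ m ≤ ℕ→ℚ n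
  ℕ→ℚ-mono-≤ {m} m≤n with ℕ.m≤n⇒∃[o]m+o≡n m≤n
  ... | o , refl = ≤-by-gap (ℕ→ℚ o) (ℕ→ℚ-+ m o) (0≤ℕ→ℚ o)

  frac-*-cancel : ∀ a b .{{_ : ℕ.NonZero b}} → frac a b * ℕ→ℚ b ≡ ℕ→ℚ a
  frac-*-cancel a (suc b) = toℚᵘ-injective (begin
    toℚᵘ (frac a (suc b) * ℕ→ℚ (suc b))
      ≈⟨ toℚᵘ-homo-* (frac a (suc b)) (ℕ→ℚ (suc b)) ⟩
    toℚᵘ (frac a (suc b)) ℚᵘ.* toℚᵘ (ℕ→ℚ (suc b))
      ≈⟨ ℚᵘ.*-cong (toℚᵘ-fromℚᵘ (ℚᵘ.mkℚᵘ (ℤ.+ a) b)) (toℚᵘ-ℕ→ℚ (suc b)) ⟩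
    ℚᵘ.mkℚᵘ (ℤ.+ a) b ℚᵘ.* ℚᵘ.mkℚᵘ (ℤ.+ suc b) 0
      ≈⟨ ℚᵘ.*≡* (trans (ℤ.*-identityʳ _) (cong (λ n → ℤ.+ a ℤ.* ℤ.+ n) (sym (ℕ.*-identityʳ (suc b))))) ⟩
    ℚᵘ.mkℚᵘ (ℤ.+ a) 0
      ≈⟨ toℚᵘ-ℕ→ℚ a ⟨
    toℚᵘ (ℕ→ℚ a) ∎)
    where open ℚᵘ.≃-Reasoning

  frac-≤ : ∀ a b .{{_ : ℕ.NonZero b}} {r} → ℕ→ℚ a ≤ r * ℕ→ℚ b → frac a b ≤ r
  frac-≤ a b {r} a≤rb = *-cancelʳ-≤-pos (ℕ→ℚ b) {{positive (ℕ→ℚ-pos b)}}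
    (subst (_≤ r * ℕ→ℚ b) (sym (frac-*-cancel a b)) a≤rb)

  ≤-frac : ∀ a b .{{_ : ℕ.NonZero b}} {r} → r * ℕ→ℚ b ≤ ℕ→ℚ a → r ≤ frac a b
  ≤-frac a b {r} rb≤a = *-cancelʳ-≤-pos (ℕ→ℚ b) {{positive (ℕ→ℚ-pos b)}}
    (subst (r * ℕ→ℚ b ≤_) (sym (frac-*-cancel a b)) rb≤a)

  ≤∣-∣ : ∀ {a b r} → 0ℚ ≤ r → a + r ≤ b → r ≤ ∣ a - b ∣
  ≤∣-∣ {a} {b} {r} 0≤r a+r≤b = begin
    r                 ≤⟨ r≤b-a ⟩
    b - a             ≡⟨ 0≤p⇒∣p∣≡p (≤-trans 0≤r r≤b-a) ⟨
    ∣ b - a ∣         ≡⟨ ∣-p∣≡∣p∣ (b - a) ⟨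
    ∣ - (b - a) ∣     ≡⟨ cong ∣_∣ (negate a b) ⟩
    ∣ a - b ∣         ∎
    where
    open ≤-Reasoning
    cancel : ∀ a r → (a + r) - a ≡ r
    cancel = solve-∀ ℚ-ring
    negate : ∀ a b → - (b - a) ≡ a - b
    negate = solve-∀ ℚ-ring
    r≤b-a : r ≤ b - a
    r≤b-a = subst (_≤ b - a) (cancel a r) (+-monoˡ-≤ (- a) a+r≤b)

  -- Finite sums and counts

  sumℚ-cong : ∀ {m} {f g : Fin m → ℚ} → (∀ i → f i ≡ g i) → sumℚ f ≡ sumℚ g
  sumℚ-cong {zero}  f≡g = refl
  sumℚ-cong {suc m} f≡g = cong₂ _+_ (f≡g zero) (sumℚ-cong (λ i → f≡g (suc i)))

  sumℚ-mono-≤ : ∀ {m} {f g : Fin m → ℚ} → (∀ i → f i ≤ g i) → sumℚ f ≤ sumℚ g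
  sumℚ-mono-≤ {zero}  f≤g = ≤-refl
  sumℚ-mono-≤ {suc m} f≤g = +-mono-≤ (f≤g zero) (sumℚ-mono-≤ (λ i → f≤g (suc i)))

  sumℚ-mono-< : ∀ {m} {f g : Fin m → ℚ} → (∀ i → f i ≤ g i) → ∀ i → f i < g i → sumℚ f < sumℚ g
  sumℚ-mono-< f≤g zero    f<g = +-mono-<-≤ f<g (sumℚ-mono-≤ (λ i → f≤g (suc i)))
  sumℚ-mono-< f≤g (suc i) f<g = +-mono-≤-< (f≤g zero) (sumℚ-mono-< (λ i → f≤g (suc i)) i f<g)

  sumℚ-nonNeg : ∀ {m} {f : Fin m → ℚ} → (∀ i → 0ℚ ≤ f i) → 0ℚ ≤ sumℚ f
  sumℚ-nonNeg {zero}  0≤f = ≤-refl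
  sumℚ-nonNeg {suc m} 0≤f = +-nonNeg (0≤f zero) (sumℚ-nonNeg (λ i → 0≤f (suc i)))

  sumℚ-+ : ∀ {m} (f g : Fin m → ℚ) → sumℚ (λ i → f i + g i) ≡ sumℚ f + sumℚ g
  sumℚ-+ {zero}  f g = refl
  sumℚ-+ {suc m} f g = trans (cong ((f zero + g zero) +_) (sumℚ-+ (λ i → f (suc i)) (λ i → g (suc i))))
    (interchange (f zero) (g zero) _ _)
    where
    interchange : ∀ a b c d → (a + b) + (c + d) ≡ (a + c) + (b + d)
    interchange = solve-∀ ℚ-ring

  sumℚ-- : ∀ {m} (f g : Fin m → ℚ) → sumℚ (λ i → f i - g i) ≡ sumℚ f - sumℚ g
  sumℚ-- {zero}  f g = refl
  sumℚ-- {suc m} f g = trans (cong ((f zero - g zero) +_) (sumℚ-- (λ i → f (suc i)) (λ i → g (suc i))))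
    (interchange (f zero) (g zero) _ _)
    where
    interchange : ∀ a b c d → (a - b) + (c - d) ≡ (a + c) - (b + d)
    interchange = solve-∀ ℚ-ring

  sumℚ-*ˡ : ∀ {m} c (f : Fin m → ℚ) → sumℚ (λ i → c * f i) ≡ c * sumℚ f
  sumℚ-*ˡ {zero}  c f = sym (*-zeroʳ c)
  sumℚ-*ˡ {suc m} c f = trans (cong (c * f zero +_) (sumℚ-*ˡ c (λ i → f (suc i))))
    (sym (*-distribˡ-+ c (f zero) _))

  sumℚ-*ʳ : ∀ {m} c (f : Fin m → ℚ) → sumℚ (λ i → f i * c) ≡ sumℚ f * c
  sumℚ-*ʳ c f = trans (sumℚ-cong (λ i → *-comm (f i) c)) (trans (sumℚ-*ˡ c f) (*-comm c (sumℚ f)))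

  sumℚ-const : ∀ {m} c → sumℚ {m} (λ _ → c) ≡ ℕ→ℚ m * c
  sumℚ-const {zero}  c = sym (*-zeroˡ c)
  sumℚ-const {suc m} c = begin
    c + sumℚ {m} (λ _ → c)   ≡⟨ cong (c +_) (sumℚ-const {m} c) ⟩
    c + ℕ→ℚ m * c            ≡⟨ cong (_+ ℕ→ℚ m * c) (sym (*-identityˡ c)) ⟩
    1ℚ * c + ℕ→ℚ m * c       ≡⟨ *-distribʳ-+ c 1ℚ (ℕ→ℚ m) ⟨
    (1ℚ + ℕ→ℚ m) * c         ≡⟨ cong (_* c) (ℕ→ℚ-+ 1 m) ⟨
    ℕ→ℚ (suc m) * c          ∎
    where open ≡-Reasoning

  sumℚ-swap : ∀ {m n} (f : Fin m → Fin n → ℚ) →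
              sumℚ (λ i → sumℚ (λ j → f i j)) ≡ sumℚ (λ j → sumℚ (λ i → f i j))
  sumℚ-swap {zero}  {n} f = sym (trans (sumℚ-const {n} 0ℚ) (*-zeroʳ (ℕ→ℚ n)))
  sumℚ-swap {suc m} {n} f = trans (cong (sumℚ (f zero) +_) (sumℚ-swap (λ i → f (suc i))))
    (sym (sumℚ-+ (f zero) (λ j → sumℚ (λ i → f (suc i) j))))

  sumℚ-weighted-swap : ∀ {k n m} (w : Fin n → Fin m → ℚ) (g : Fin k → Fin n → Fin m → ℚ) →
    sumℚ (λ j → sumℚ (λ u → sumℚ (λ v → w u v * g j u v))) ≡ sumℚ (λ u → sumℚ (λ v → w u v * sumℚ (λ j → g j u v)))
  sumℚ-weighted-swap w g = trans (sumℚ-swap (λ j u → sumℚ (λ v → w u v * g j u v)))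
    (sumℚ-cong (λ u → trans (sumℚ-swap (λ j v → w u v * g j u v))
      (sumℚ-cong (λ v → sumℚ-*ˡ (w u v) (λ j → g j u v)))))

  ℕ→ℚ-sumFin : ∀ {m} (f : Fin m → ℕ) → ℕ→ℚ (sumFin f) ≡ sumℚ (λ i → ℕ→ℚ (f i))
  ℕ→ℚ-sumFin {zero}  f = refl
  ℕ→ℚ-sumFin {suc m} f = trans (ℕ→ℚ-+ (f zero) _) (cong (ℕ→ℚ (f zero) +_) (ℕ→ℚ-sumFin (λ i → f (suc i))))

  𝟙 : Bool → ℚ
  𝟙 true  = 1ℚ
  𝟙 false = 0ℚ

  0≤𝟙 : ∀ b → 0ℚ ≤ 𝟙 b
  0≤𝟙 true  = nonNegative⁻¹ 1ℚ
  0≤𝟙 false = ≤-refl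

  ℕ→ℚ-count : ∀ {m} (P : Fin m → Bool) → ℕ→ℚ (count P) ≡ sumℚ (λ i → 𝟙 (P i))
  ℕ→ℚ-count {zero}  P = refl
  ℕ→ℚ-count {suc m} P = trans (ℕ→ℚ-+ (if P zero then 1 else 0) _)
    (cong₂ _+_ (ℕ→ℚ-if (P zero)) (ℕ→ℚ-count (λ i → P (suc i))))
    where
    ℕ→ℚ-if : ∀ b → ℕ→ℚ (if b then 1 else 0) ≡ 𝟙 b
    ℕ→ℚ-if true  = refl
    ℕ→ℚ-if false = refl

  count≤ : ∀ {m} (P : Fin m → Bool) → count P ℕ.≤ m
  count≤ {zero}  P = ℕ.z≤n
  count≤ {suc m} P with P zero
  ... | true  = ℕ.s≤s (count≤ (λ i → P (suc i)))
  ... | false = ℕ.m≤n⇒m≤1+n (count≤ (λ i → P (suc i)))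

  count-full : ∀ {m} → count {m} full ≡ m
  count-full {zero}  = refl
  count-full {suc m} = cong suc (count-full {m})

  count-none : ∀ {m} → count {m} (λ _ → false) ≡ 0
  count-none {zero}  = refl
  count-none {suc m} = count-none {m}

  sumFin-pos : ∀ {m} (f : Fin m → ℕ) → 0 ℕ.< sumFin f → ∃ λ i → 0 ℕ.< f i
  sumFin-pos {suc m} f 0<Σ with f zero in f₀
  ... | suc _ = zero , subst (0 ℕ.<_) (sym f₀) (ℕ.s≤s ℕ.z≤n)
  ... | zero  = let i , 0<fi = sumFin-pos (λ i → f (suc i)) 0<Σ in suc i , 0<fi

  count-pos : ∀ {m} (P : Fin m → Bool) → 0 ℕ.< count P → ∃ λ i → P i ≡ true
  count-pos {suc m} P 0<count with P zero in P₀
  ... | true  = zero , P₀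
  ... | false = let i , Pi = count-pos (λ i → P (suc i)) 0<count in suc i , Pi

  ∃-above-average : ∀ {n m} (A : Fin n → Fin m → Bool) (g : Fin n → Fin m → ℚ) R →
    (∃ λ u → ∃ λ v → A u v ≡ true) →
    sumℚ (λ u → sumℚ (λ v → 𝟙 (A u v) * R)) ≤ sumℚ (λ u → sumℚ (λ v → 𝟙 (A u v) * g u v)) →
    ∃ λ u → ∃ λ v → A u v ≡ true × R ≤ g u v
  ∃-above-average A g R (u₀ , v₀ , A₀) avg≤
    with any? (λ u → any? (λ v → (A u v Bool.≟ true) ×-dec (R ≤? g u v)))
  ... | yes found = found
  ... | no none = ⊥-elim (<-irrefl refl (<-≤-trans total< avg≤))
    where
    below : ∀ {u v} → A u v ≡ true → g u v < R
    below {u} {v} Auv = ≰⇒> (λ R≤g → none (u , v , Auv , R≤g))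
    term< : ∀ {u v} → A u v ≡ true → 𝟙 (A u v) * g u v < 𝟙 (A u v) * R
    term< {u} {v} Auv rewrite Auv = subst₂ _<_ (sym (*-identityˡ (g u v))) (sym (*-identityˡ R)) (below Auv)
    term≤ : ∀ u v → 𝟙 (A u v) * g u v ≤ 𝟙 (A u v) * R
    term≤ u v with A u v in Auv
    ... | true  = *-monoˡ-≤-nonNeg 1ℚ {{nonNegative (0≤𝟙 true)}} (<⇒≤ (below Auv))
    ... | false = ≤-reflexive (trans (*-zeroˡ (g u v)) (sym (*-zeroˡ R)))
    total< : sumℚ (λ u → sumℚ (λ v → 𝟙 (A u v) * g u v)) < sumℚ (λ u → sumℚ (λ v → 𝟙 (A u v) * R))
    total< = sumℚ-mono-< (λ u → sumℚ-mono-≤ (term≤ u)) u₀ (sumℚ-mono-< (term≤ u₀) v₀ (term< A₀))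

  -- Degrees and ε-uniform pairs

  module _ {m t : ℕ} (H : SimpleGraph (Vtx m t)) where

    degIn : Fin m → Fin m → Sub t → Fin t → ℕ
    degIn p q Y a = count (λ b → Y b ∧ adj H (p , a) (q , b))

    lowDegree : Fin m → Fin m → Sub t → ℚ → Sub t
    lowDegree p q Y δ a = isYes (ℕ→ℚ (degIn p q Y a) <? δ * ℕ→ℚ (count Y))

    lowDegree-true : ∀ {p q Y δ a} → lowDegree p q Y δ a ≡ true → ℕ→ℚ (degIn p q Y a) < δ * ℕ→ℚ (count Y)
    lowDegree-true {p} {q} {Y} {δ} {a} low = toWitness {a? = ℕ→ℚ (degIn p q Y a) <? δ * ℕ→ℚ (count Y)}
      (Equivalence.from (T-≡ {lowDegree p q Y δ a}) low)

    lowDegree-false : ∀ {p q Y δ a} → lowDegree p q Y δ a ≡ false → δ * ℕ→ℚ (count Y) ≤ ℕ→ℚ (degIn p q Y a)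
    lowDegree-false {p} {q} {Y} {δ} {a} not-low = ≮⇒≥ (toWitnessFalse {a? = ℕ→ℚ (degIn p q Y a) <? δ * ℕ→ℚ (count Y)}
      (Equivalence.from (T-not-≡ {lowDegree p q Y δ a}) not-low))

    eSub-≤ : ∀ {p q X Y c} → (∀ a → X a ≡ true → ℕ→ℚ (degIn p q Y a) ≤ c) →
             ℕ→ℚ (eSub H p q X Y) ≤ c * ℕ→ℚ (count X)
    eSub-≤ {p} {q} {X} {Y} {c} deg≤ = begin
      ℕ→ℚ (eSub H p q X Y)
        ≡⟨ ℕ→ℚ-sumFin (λ a → count (λ b → X a ∧ Y b ∧ adj H (p , a) (q , b))) ⟩
      sumℚ (λ a → ℕ→ℚ (count (λ b → X a ∧ Y b ∧ adj H (p , a) (q , b))))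
        ≤⟨ sumℚ-mono-≤ row ⟩
      sumℚ (λ a → c * 𝟙 (X a))
        ≡⟨ sumℚ-*ˡ c (λ a → 𝟙 (X a)) ⟩
      c * sumℚ (λ a → 𝟙 (X a))
        ≡⟨ cong (c *_) (ℕ→ℚ-count X) ⟨
      c * ℕ→ℚ (count X) ∎
      where
      open ≤-Reasoning
      row : ∀ a → ℕ→ℚ (count (λ b → X a ∧ Y b ∧ adj H (p , a) (q , b))) ≤ c * 𝟙 (X a)
      row a with X a in Xa
      ... | true  = subst (ℕ→ℚ (degIn p q Y a) ≤_) (sym (*-identityʳ c)) (deg≤ a Xa)
      ... | false = ≤-reflexive (trans (cong ℕ→ℚ (count-none {t})) (sym (*-zeroʳ c)))

    few-lowDegree : ∀ {ε D p q Y} .{{_ : ℕ.NonZero t}} → 0ℚ < ε → Uniform ε H p q →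
                    D ≤ dens H p q full full → ε * ℕ→ℚ t ≤ ℕ→ℚ (count Y) →
                    ℕ→ℚ (count (lowDegree p q Y (D - ε))) < ε * ℕ→ℚ t
    -- At least εt such vertices would form a set X with d(X, Y) ≤ D - ε ≤ d(A, B) - ε.
    few-lowDegree {ε} {D} {p} {q} {Y} 0<ε uniform D≤d εt≤|Y| =
      decidable-stable (ℕ→ℚ (count X) <? ε * ℕ→ℚ t) λ ¬few →
        <-irrefl refl (≤-<-trans (ε≤gap (≮⇒≥ ¬few)) (uniform X Y (≮⇒≥ ¬few) εt≤|Y|))
      where
      X : Sub t
      X = lowDegree p q Y (D - ε)
      0<εt : 0ℚ < ε * ℕ→ℚ t
      0<εt = *-pos 0<ε (ℕ→ℚ-pos t)
      rearrange : ∀ δ x y → δ * y * x ≡ δ * (x * y)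
      rearrange = solve-∀ ℚ-ring
      cancel : ∀ D ε → (D - ε) + ε ≡ D
      cancel = solve-∀ ℚ-ring
      ε≤gap : ε * ℕ→ℚ t ≤ ℕ→ℚ (count X) → ε ≤ ∣ dens H p q X Y - dens H p q full full ∣
      ε≤gap εt≤|X| = ≤∣-∣ {dens H p q X Y} {dens H p q full full} (<⇒≤ 0<ε) (begin
        dens H p q X Y + ε   ≤⟨ +-monoˡ-≤ ε d[X,Y]≤ ⟩
        (D - ε) + ε          ≡⟨ cancel D ε ⟩
        D                    ≤⟨ D≤d ⟩
        dens H p q full full ∎)
        where
        open ≤-Reasoning
        instance
          |X|≢0 : ℕ.NonZero (count X)
          |X|≢0 = ℕ→ℚ-pos⁻¹ (<-≤-trans 0<εt εt≤|X|)
          |Y|≢0 : ℕ.NonZero (count Y)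
          |Y|≢0 = ℕ→ℚ-pos⁻¹ (<-≤-trans 0<εt εt≤|Y|)
        e[X,Y]≤ : ℕ→ℚ (eSub H p q X Y) ≤ (D - ε) * ℕ→ℚ (count X ℕ.* count Y)
        e[X,Y]≤ = subst (ℕ→ℚ (eSub H p q X Y) ≤_)
          (trans (rearrange (D - ε) (ℕ→ℚ (count X)) (ℕ→ℚ (count Y))) (cong ((D - ε) *_) (sym (ℕ→ℚ-* (count X) (count Y)))))
          (eSub-≤ {p} {q} {X} {Y} (λ a Xa → <⇒≤ (lowDegree-true {p} {q} {Y} {D - ε} {a} Xa)))
        d[X,Y]≤ : dens H p q X Y ≤ D - ε
        d[X,Y]≤ = frac-≤ (eSub H p q X Y) (count X ℕ.* count Y) {{ℕ.m*n≢0 (count X) (count Y)}} e[X,Y]≤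

    eSub-full-≤ : ∀ {p q} → ℕ→ℚ (eSub H p q full full) ≤ ℕ→ℚ t * ℕ→ℚ t
    eSub-full-≤ {p} {q} = subst (λ n → ℕ→ℚ (eSub H p q full full) ≤ ℕ→ℚ t * ℕ→ℚ n) (count-full {t})
      (eSub-≤ {p} {q} {full} {full} {ℕ→ℚ t} (λ a _ → ℕ→ℚ-mono-≤ (count≤ (λ b → adj H (p , a) (q , b)))))

    ≤dens-full : ∀ {p q x} .{{_ : ℕ.NonZero t}} → x * ℕ→ℚ (t ℕ.* t) ≤ ℕ→ℚ (eSub H p q full full) →
                 x ≤ dens H p q full full
    ≤dens-full {p} {q} {x} x≤e = subst (λ n → x ≤ frac (eSub H p q full full) (n ℕ.* n)) (sym (count-full {t}))
      (≤-frac (eSub H p q full full) (t ℕ.* t) {{ℕ.m*n≢0 t t}} x≤e)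

    ≤1-of-≤eSub : ∀ {p q x} .{{_ : ℕ.NonZero t}} → x * ℕ→ℚ (t ℕ.* t) ≤ ℕ→ℚ (eSub H p q full full) → x ≤ 1ℚ
    ≤1-of-≤eSub {p} {q} {x} x≤e =
      *-cancelʳ-≤-pos (ℕ→ℚ (t ℕ.* t)) {{positive (ℕ→ℚ-pos (t ℕ.* t) {{ℕ.m*n≢0 t t}})}} (begin
      x * ℕ→ℚ (t ℕ.* t)             ≤⟨ x≤e ⟩
      ℕ→ℚ (eSub H p q full full)    ≤⟨ eSub-full-≤ ⟩
      ℕ→ℚ t * ℕ→ℚ t                 ≡⟨ ℕ→ℚ-* t t ⟨
      ℕ→ℚ (t ℕ.* t)                 ≡⟨ *-identityˡ (ℕ→ℚ (t ℕ.* t)) ⟨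
      1ℚ * ℕ→ℚ (t ℕ.* t)            ∎)
      where open ≤-Reasoning

  weighted-pairs-≥ : ∀ {n m} (A bad : Fin n → Fin m → Bool) (x : Fin n → Fin m → ℚ) {P} → 0ℚ ≤ P →
    (∀ u v → 0ℚ ≤ x u v) → (∀ u v → A u v ≡ true → bad u v ≡ false → P ≤ x u v) →
    P * (sumℚ (λ u → ℕ→ℚ (count (A u))) - sumℚ (λ u → ℕ→ℚ (count (bad u))))
      ≤ sumℚ (λ u → sumℚ (λ v → 𝟙 (A u v) * x u v))
  weighted-pairs-≥ A bad x {P} 0≤P 0≤x P≤x = begin
    P * (sumℚ (λ u → ℕ→ℚ (count (A u))) - sumℚ (λ u → ℕ→ℚ (count (bad u))))
      ≡⟨ cong (P *_) (sumℚ-- (λ u → ℕ→ℚ (count (A u))) (λ u → ℕ→ℚ (count (bad u)))) ⟨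
    P * sumℚ (λ u → ℕ→ℚ (count (A u)) - ℕ→ℚ (count (bad u)))
      ≡⟨ sumℚ-*ˡ P (λ u → ℕ→ℚ (count (A u)) - ℕ→ℚ (count (bad u))) ⟨
    sumℚ (λ u → P * (ℕ→ℚ (count (A u)) - ℕ→ℚ (count (bad u))))
      ≡⟨ sumℚ-cong row-sum ⟨
    sumℚ (λ u → sumℚ (λ v → P * (𝟙 (A u v) - 𝟙 (bad u v))))
      ≤⟨ sumℚ-mono-≤ (λ u → sumℚ-mono-≤ (term u)) ⟩
    sumℚ (λ u → sumℚ (λ v → 𝟙 (A u v) * x u v)) ∎
    where
    open ≤-Reasoning
    row-sum : ∀ u → sumℚ (λ v → P * (𝟙 (A u v) - 𝟙 (bad u v))) ≡ P * (ℕ→ℚ (count (A u)) - ℕ→ℚ (count (bad u)))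
    row-sum u = trans (sumℚ-*ˡ P (λ v → 𝟙 (A u v) - 𝟙 (bad u v)))
      (cong (P *_) (trans (sumℚ-- (λ v → 𝟙 (A u v)) (λ v → 𝟙 (bad u v)))
      (sym (cong₂ _-_ (ℕ→ℚ-count (A u)) (ℕ→ℚ-count (bad u))))))
    gap-false : ∀ P x y → 0ℚ * x ≡ P * (0ℚ - y) + P * y
    gap-false = solve-∀ ℚ-ring
    gap-bad : ∀ P x → 1ℚ * x ≡ P * (1ℚ - 1ℚ) + x
    gap-bad = solve-∀ ℚ-ring
    gap-good : ∀ P x → 1ℚ * x ≡ P * (1ℚ - 0ℚ) + (x - P)
    gap-good = solve-∀ ℚ-ring
    term : ∀ u v → P * (𝟙 (A u v) - 𝟙 (bad u v)) ≤ 𝟙 (A u v) * x u v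
    term u v with A u v in Auv | bad u v in bad-uv
    ... | false | b     = ≤-by-gap _ (gap-false P (x u v) (𝟙 b)) (*-nonNeg 0≤P (0≤𝟙 b))
    ... | true  | true  = ≤-by-gap _ (gap-bad P (x u v)) (0≤x u v)
    ... | true  | false = ≤-by-gap _ (gap-good P (x u v)) (p≤q⇒0≤q-p (P≤x u v Auv bad-uv))

  badPairs-≤ : ∀ {n m} (bad₁ : Fin n → Bool) (bad₂ : Fin n → Fin m → Bool) {β} → 0ℚ ≤ β →
    ℕ→ℚ (count bad₁) ≤ β → (∀ u → bad₁ u ≡ false → ℕ→ℚ (count (bad₂ u)) ≤ β) →
    sumℚ (λ u → ℕ→ℚ (count (λ v → bad₁ u ∨ bad₂ u v))) ≤ ℕ→ℚ m * β + ℕ→ℚ n * β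
  badPairs-≤ {n} {m} bad₁ bad₂ {β} 0≤β |bad₁|≤β |bad₂|≤β = begin
    sumℚ (λ u → ℕ→ℚ (count (λ v → bad₁ u ∨ bad₂ u v)))
      ≤⟨ sumℚ-mono-≤ row ⟩
    sumℚ (λ u → ℕ→ℚ m * 𝟙 (bad₁ u) + β)
      ≡⟨ sumℚ-+ (λ u → ℕ→ℚ m * 𝟙 (bad₁ u)) (λ _ → β) ⟩
    sumℚ (λ u → ℕ→ℚ m * 𝟙 (bad₁ u)) + sumℚ {n} (λ _ → β)
      ≡⟨ cong₂ _+_ (sumℚ-*ˡ (ℕ→ℚ m) (λ u → 𝟙 (bad₁ u))) (sumℚ-const {n} β) ⟩
    ℕ→ℚ m * sumℚ (λ u → 𝟙 (bad₁ u)) + ℕ→ℚ n * β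
      ≡⟨ cong (λ s → ℕ→ℚ m * s + ℕ→ℚ n * β) (ℕ→ℚ-count bad₁) ⟨
    ℕ→ℚ m * ℕ→ℚ (count bad₁) + ℕ→ℚ n * β
      ≤⟨ +-monoˡ-≤ (ℕ→ℚ n * β) (*-monoˡ-≤-nonNeg (ℕ→ℚ m) {{nonNegative (0≤ℕ→ℚ m)}} |bad₁|≤β) ⟩
    ℕ→ℚ m * β + ℕ→ℚ n * β ∎
    where
    open ≤-Reasoning
    gap-bad : ∀ M β → M * 1ℚ + β ≡ M + β
    gap-bad = solve-∀ ℚ-ring
    gap-good : ∀ M c β → M * 0ℚ + β ≡ c + (β - c)
    gap-good = solve-∀ ℚ-ring
    row : ∀ u → ℕ→ℚ (count (λ v → bad₁ u ∨ bad₂ u v)) ≤ ℕ→ℚ m * 𝟙 (bad₁ u) + β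
    row u with bad₁ u in bad₁-u
    ... | true  = ≤-by-gap β (trans (gap-bad (ℕ→ℚ m) β) (cong (λ c → ℕ→ℚ c + β) (sym (count-full {m})))) 0≤β
    ... | false = ≤-by-gap _ (gap-good (ℕ→ℚ m) (ℕ→ℚ (count (bad₂ u))) β) (p≤q⇒0≤q-p (|bad₂|≤β u bad₁-u))

  -- E times the j-th summand of the bound, for T = t, E = e(A₁, A₂), x = d₁ⱼ and y = d₂ⱼ.
  partTarget : (ε T E x y : ℚ) → ℚ
  partTarget ε T E x y = T * (x * y) * (E - ℕ→ℚ 2 * ε * (T * T)) - ℕ→ℚ 2 * ε * T * E

  partTarget≤ : ∀ {ε T E x y} → 0ℚ ≤ ε → 0ℚ ≤ T → 0ℚ ≤ E → x ≤ 1ℚ → y ≤ 1ℚ → ε ≤ x - ε → 0ℚ ≤ y →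
                partTarget ε T E x y ≤ (y - ε) * ((x - ε) * T) * (E - ℕ→ℚ 2 * ε * (T * T))
  partTarget≤ {ε} {T} {E} {x} {y} 0≤ε 0≤T 0≤E x≤1 y≤1 ε≤x-ε 0≤y = ≤-by-gap _ (expand ε T E x y)
    (+-nonNeg (*-nonNeg (*-nonNeg (*-nonNeg 0≤ε 0≤T) 0≤E) (+-nonNeg (+-nonNeg (p≤q⇒0≤q-p x≤1) (p≤q⇒0≤q-p y≤1)) 0≤ε))
              (*-nonNeg (*-nonNeg (*-nonNeg (*-nonNeg (0≤ℕ→ℚ 2) 0≤ε) 0≤ε) (*-nonNeg 0≤T (*-nonNeg 0≤T 0≤T)))
                        (+-nonNeg (≤-trans 0≤ε ε≤x-ε) 0≤y)))
    where
    -- ℕ→ℚ 2 and 1ℚ + 1ℚ have the same closed normal form; the ring solver only understands the latter.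
    expand : ∀ ε T E x y →
      (y - ε) * ((x - ε) * T) * (E - (1ℚ + 1ℚ) * ε * (T * T))
        ≡ (T * (x * y) * (E - (1ℚ + 1ℚ) * ε * (T * T)) - (1ℚ + 1ℚ) * ε * T * E)
          + (ε * T * E * ((1ℚ - x) + (1ℚ - y) + ε) + (1ℚ + 1ℚ) * ε * ε * (T * (T * T)) * ((x - ε) + y))
    expand = solve-∀ ℚ-ring

  partTarget≤0 : ∀ {ε T E x y} → 0ℚ ≤ ε → 0ℚ ≤ T → 0ℚ ≤ E → 0ℚ ≤ x → 0ℚ ≤ y → x ≤ 1ℚ → y ≤ 1ℚ →
                 x - ε < ε ⊎ y - ε < ε → partTarget ε T E x y ≤ 0ℚ
  partTarget≤0 {ε} {T} {E} {x} {y} 0≤ε 0≤T 0≤E 0≤x 0≤y x≤1 y≤1 (inj₁ x-ε<ε) = ≤-by-gap _ (expand ε T E x y)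
    (+-nonNeg (*-nonNeg (*-nonNeg 0≤T 0≤E) (+-nonNeg (p≤q⇒0≤q-p (<⇒≤ x-ε<ε)) (*-nonNeg 0≤x (p≤q⇒0≤q-p y≤1))))
              (*-nonNeg (*-nonNeg (*-nonNeg (0≤ℕ→ℚ 2) 0≤ε) (*-nonNeg 0≤T (*-nonNeg 0≤T 0≤T))) (*-nonNeg 0≤x 0≤y)))
    where
    expand : ∀ ε T E x y →
      0ℚ ≡ (T * (x * y) * (E - (1ℚ + 1ℚ) * ε * (T * T)) - (1ℚ + 1ℚ) * ε * T * E)
           + (T * E * ((ε - (x - ε)) + x * (1ℚ - y)) + (1ℚ + 1ℚ) * ε * (T * (T * T)) * (x * y))
    expand = solve-∀ ℚ-ring
  partTarget≤0 {ε} {T} {E} {x} {y} 0≤ε 0≤T 0≤E 0≤x 0≤y x≤1 y≤1 (inj₂ y-ε<ε) =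
    subst (_≤ 0ℚ) (cong (λ xy → T * xy * (E - ℕ→ℚ 2 * ε * (T * T)) - ℕ→ℚ 2 * ε * T * E) (*-comm y x))
      (partTarget≤0 0≤ε 0≤T 0≤E 0≤y 0≤x y≤1 x≤1 (inj₁ y-ε<ε))

  -- The parts A₁, A₂, B₁, …, B_k

  module Parts {k t : ℕ} .{{_ : ℕ.NonZero t}} (H : SimpleGraph (Vtx (2 ℕ.+ k) t)) {ε : ℚ} (0<ε : 0ℚ < ε) where

    A₁ A₂ : Fin (2 ℕ.+ k)
    A₁ = zero
    A₂ = suc zero

    B : Fin k → Fin (2 ℕ.+ k)
    B j = 2 ↑ʳ j

    T E : ℚ
    T = ℕ→ℚ t
    E = ℕ→ℚ (eSub H A₁ A₂ full full)

    edge : Fin t → Fin t → Bool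
    edge u v = adj H (A₁ , u) (A₂ , v)

    nbhd : Fin k → Fin t → Sub t
    nbhd j u b = adj H (A₁ , u) (B j , b)

    codegree : Fin k → Fin t → Fin t → ℕ
    codegree j u v = degIn H A₂ (B j) (nbhd j u) v

    edgeSum : (Fin t → Fin t → ℚ) → ℚ
    edgeSum g = sumℚ (λ u → sumℚ (λ v → 𝟙 (edge u v) * g u v))

    0≤ε : 0ℚ ≤ ε
    0≤ε = <⇒≤ 0<ε

    0≤T : 0ℚ ≤ T
    0≤T = 0≤ℕ→ℚ t

    E≡edgeCount : E ≡ sumℚ (λ u → ℕ→ℚ (count (edge u)))
    E≡edgeCount = ℕ→ℚ-sumFin (λ u → count (edge u))

    lowDeg₁ : Fin k → ℚ → Sub t
    lowDeg₁ j x = lowDegree H A₁ (B j) full (x - ε)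

    lowDeg₂ : Fin k → ℚ → Fin t → Sub t
    lowDeg₂ j y u = lowDegree H A₂ (B j) (nbhd j u) (y - ε)

    exceptional : Fin k → ℚ → ℚ → Fin t → Fin t → Bool
    exceptional j x y u v = lowDeg₁ j x u ∨ lowDeg₂ j y u v

    nbhd-≥ : ∀ j {x} u → lowDeg₁ j x u ≡ false → (x - ε) * T ≤ ℕ→ℚ (count (nbhd j u))
    nbhd-≥ j {x} u not-low = subst (λ n → (x - ε) * ℕ→ℚ n ≤ ℕ→ℚ (count (nbhd j u))) (count-full {t})
      (lowDegree-false H {A₁} {B j} {full} {x - ε} {u} not-low)

    codegree-≥ : ∀ j {x y} u v → 0ℚ ≤ y - ε → exceptional j x y u v ≡ false →
                 (y - ε) * ((x - ε) * T) ≤ ℕ→ℚ (codegree j u v)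
    codegree-≥ j {x} {y} u v 0≤y-ε not-exceptional = ≤-trans
      (*-monoˡ-≤-nonNeg (y - ε) {{nonNegative 0≤y-ε}}
        (nbhd-≥ j {x} u (∨-conicalˡ (lowDeg₁ j x u) (lowDeg₂ j y u v) not-exceptional)))
      (lowDegree-false H {A₂} {B j} {nbhd j u} {y - ε} {v}
        (∨-conicalʳ (lowDeg₁ j x u) (lowDeg₂ j y u v) not-exceptional))

    exceptional-≤ : ∀ j {x y} → Uniform ε H A₁ (B j) → Uniform ε H A₂ (B j) →
      x ≤ dens H A₁ (B j) full full → y ≤ dens H A₂ (B j) full full → x ≤ 1ℚ → ε ≤ x - ε →
      sumℚ (λ u → ℕ→ℚ (count (exceptional j x y u))) ≤ ℕ→ℚ 2 * ε * (T * T)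
    exceptional-≤ j {x} {y} uniform₁ uniform₂ x≤d₁ y≤d₂ x≤1 ε≤x-ε =
      subst (sumℚ (λ u → ℕ→ℚ (count (exceptional j x y u))) ≤_) (double ε T)
        (badPairs-≤ (lowDeg₁ j x) (lowDeg₂ j y) (*-nonNeg 0≤ε 0≤T) |low₁|≤ |low₂|≤)
      where
      cancel : ∀ x ε → (x - ε) + ε ≡ x
      cancel = solve-∀ ℚ-ring
      double : ∀ ε T → T * (ε * T) + T * (ε * T) ≡ (1ℚ + 1ℚ) * ε * (T * T)
      double = solve-∀ ℚ-ring
      ε≤1 : ε ≤ 1ℚ
      ε≤1 = ≤-trans ε≤x-ε (≤-trans (≤-by-gap ε (sym (cancel x ε)) 0≤ε) x≤1)
      εT≤|full| : ε * T ≤ ℕ→ℚ (count {t} full)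
      εT≤|full| = subst (λ n → ε * T ≤ ℕ→ℚ n) (sym (count-full {t}))
        (subst (ε * T ≤_) (*-identityˡ T) (*-monoʳ-≤-nonNeg T {{nonNegative 0≤T}} ε≤1))
      |low₁|≤ : ℕ→ℚ (count (lowDeg₁ j x)) ≤ ε * T
      |low₁|≤ = <⇒≤ (few-lowDegree H {ε} {x} {A₁} {B j} {full} 0<ε uniform₁ x≤d₁ εT≤|full|)
      |low₂|≤ : ∀ u → lowDeg₁ j x u ≡ false → ℕ→ℚ (count (lowDeg₂ j y u)) ≤ ε * T
      |low₂|≤ u not-low = <⇒≤ (few-lowDegree H {ε} {y} {A₂} {B j} {nbhd j u} 0<ε uniform₂ y≤d₂
        (≤-trans (*-monoʳ-≤-nonNeg T {{nonNegative 0≤T}} ε≤x-ε) (nbhd-≥ j {x} u not-low)))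

    codegree-sum-≥ : ∀ j {x y} → Uniform ε H A₁ (B j) → Uniform ε H A₂ (B j) →
      x ≤ dens H A₁ (B j) full full → y ≤ dens H A₂ (B j) full full → x ≤ 1ℚ → ε ≤ x - ε → ε ≤ y - ε →
      (y - ε) * ((x - ε) * T) * (E - ℕ→ℚ 2 * ε * (T * T)) ≤ edgeSum (λ u v → ℕ→ℚ (codegree j u v))
    codegree-sum-≥ j {x} {y} uniform₁ uniform₂ x≤d₁ y≤d₂ x≤1 ε≤x-ε ε≤y-ε = begin
      P * (E - ℕ→ℚ 2 * ε * (T * T))
        ≤⟨ *-monoˡ-≤-nonNeg P {{nonNegative 0≤P}}
             (+-monoʳ-≤ E (neg-antimono-≤ (exceptional-≤ j {x} {y} uniform₁ uniform₂ x≤d₁ y≤d₂ x≤1 ε≤x-ε))) ⟩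
      P * (E - sumℚ (λ u → ℕ→ℚ (count (exceptional j x y u))))
        ≡⟨ cong (λ e → P * (e - sumℚ (λ u → ℕ→ℚ (count (exceptional j x y u))))) E≡edgeCount ⟩
      P * (sumℚ (λ u → ℕ→ℚ (count (edge u))) - sumℚ (λ u → ℕ→ℚ (count (exceptional j x y u))))
        ≤⟨ weighted-pairs-≥ edge (exceptional j x y) (λ u v → ℕ→ℚ (codegree j u v)) 0≤P
             (λ u v → 0≤ℕ→ℚ (codegree j u v)) (λ u v _ → codegree-≥ j {x} {y} u v 0≤y-ε) ⟩
      edgeSum (λ u v → ℕ→ℚ (codegree j u v)) ∎
      where
      open ≤-Reasoning
      P : ℚ
      P = (y - ε) * ((x - ε) * T)
      0≤y-ε : 0ℚ ≤ y - ε
      0≤y-ε = ≤-trans 0≤ε ε≤y-ε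
      0≤P : 0ℚ ≤ P
      0≤P = *-nonNeg 0≤y-ε (*-nonNeg (≤-trans 0≤ε ε≤x-ε) 0≤T)

    0≤edgeSum : ∀ {g} → (∀ u v → 0ℚ ≤ g u v) → 0ℚ ≤ edgeSum g
    0≤edgeSum 0≤g = sumℚ-nonNeg (λ u → sumℚ-nonNeg (λ v → *-nonNeg (0≤𝟙 (edge u v)) (0≤g u v)))

    part-bound : ∀ j {x y} → Uniform ε H A₁ (B j) → Uniform ε H A₂ (B j) →
      x * ℕ→ℚ (t ℕ.* t) ≤ ℕ→ℚ (eSub H A₁ (B j) full full) → y * ℕ→ℚ (t ℕ.* t) ≤ ℕ→ℚ (eSub H A₂ (B j) full full) →
      0ℚ ≤ x → 0ℚ ≤ y → partTarget ε T E x y ≤ edgeSum (λ u v → ℕ→ℚ (codegree j u v))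
    part-bound j {x} {y} uniform₁ uniform₂ x≤e₁ y≤e₂ 0≤x 0≤y = by-cases (ε ≤? x - ε) (ε ≤? y - ε)
      where
      x≤1 : x ≤ 1ℚ
      x≤1 = ≤1-of-≤eSub H {A₁} {B j} {x} x≤e₁
      y≤1 : y ≤ 1ℚ
      y≤1 = ≤1-of-≤eSub H {A₂} {B j} {y} y≤e₂
      0≤E : 0ℚ ≤ E
      0≤E = 0≤ℕ→ℚ (eSub H A₁ A₂ full full)
      0≤codegrees : 0ℚ ≤ edgeSum (λ u v → ℕ→ℚ (codegree j u v))
      0≤codegrees = 0≤edgeSum (λ u v → 0≤ℕ→ℚ (codegree j u v))
      by-cases : Dec (ε ≤ x - ε) → Dec (ε ≤ y - ε) → partTarget ε T E x y ≤ edgeSum (λ u v → ℕ→ℚ (codegree j u v))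
      by-cases (yes ε≤x-ε) (yes ε≤y-ε) = ≤-trans (partTarget≤ 0≤ε 0≤T 0≤E x≤1 y≤1 ε≤x-ε 0≤y)
        (codegree-sum-≥ j uniform₁ uniform₂ (≤dens-full H {A₁} {B j} {x} x≤e₁) (≤dens-full H {A₂} {B j} {y} y≤e₂)
          x≤1 ε≤x-ε ε≤y-ε)
      by-cases (no ε≰x-ε) _ =
        ≤-trans (partTarget≤0 0≤ε 0≤T 0≤E 0≤x 0≤y x≤1 y≤1 (inj₁ (≰⇒> ε≰x-ε))) 0≤codegrees
      by-cases (yes _) (no ε≰y-ε) =
        ≤-trans (partTarget≤0 0≤ε 0≤T 0≤E 0≤x 0≤y x≤1 y≤1 (inj₂ (≰⇒> ε≰y-ε))) 0≤codegrees

    codegrees≤commonNbrs : ∀ u v → sumFin (λ j → codegree j u v) ℕ.≤ commonNbrs H (A₁ , u) (A₂ , v)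
    codegrees≤commonNbrs u v = ℕ.≤-trans (ℕ.m≤n+m (sumFin (λ j → codegree j u v)) (common A₂))
                                         (ℕ.m≤n+m (common A₂ ℕ.+ sumFin (λ j → codegree j u v)) (common A₁))
      where
      common : Fin (2 ℕ.+ k) → ℕ
      common p = count (λ a → adj H (A₁ , u) (p , a) ∧ adj H (A₂ , v) (p , a))

    bound : (x y : Fin k → ℚ) → ℚ
    bound x y = T * (1ℚ - ℕ→ℚ 2 * ε * ℕ→ℚ (t ℕ.* t) * frac 1 (eSub H A₁ A₂ full full)) * sumℚ (λ j → x j * y j)
                - ℕ→ℚ 2 * ε * ℕ→ℚ (k ℕ.* t)

    E*bound : .{{_ : ℕ.NonZero (eSub H A₁ A₂ full full)}} → ∀ x y →
              E * bound x y ≡ sumℚ (λ j → partTarget ε T E (x j) (y j))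
    E*bound x y = begin
      E * bound x y
        ≡⟨ cong₂ (λ tt kt → E * (T * (1ℚ - ℕ→ℚ 2 * ε * tt * c) * S - ℕ→ℚ 2 * ε * kt)) (ℕ→ℚ-* t t) (ℕ→ℚ-* k t) ⟩
      E * (T * (1ℚ - ℕ→ℚ 2 * ε * (T * T) * c) * S - ℕ→ℚ 2 * ε * (K * T))
        ≡⟨ expand E T c S K ε (ℕ→ℚ 2) ⟩
      T * S * (E - ℕ→ℚ 2 * ε * (T * T) * (E * c)) - K * (ℕ→ℚ 2 * ε * T * E)
        ≡⟨ cong (λ Ec → T * S * (E - ℕ→ℚ 2 * ε * (T * T) * Ec) - K * (ℕ→ℚ 2 * ε * T * E)) E*c≡1 ⟩
      T * S * (E - ℕ→ℚ 2 * ε * (T * T) * 1ℚ) - K * (ℕ→ℚ 2 * ε * T * E)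
        ≡⟨ cong (λ z → T * S * (E - z) - K * (ℕ→ℚ 2 * ε * T * E)) (*-identityʳ (ℕ→ℚ 2 * ε * (T * T))) ⟩
      T * S * G - K * (ℕ→ℚ 2 * ε * T * E)
        ≡⟨ cong₂ _-_ (cong (_* G) (sumℚ-*ˡ T (λ j → x j * y j))) (sumℚ-const {k} (ℕ→ℚ 2 * ε * T * E)) ⟨
      sumℚ (λ j → T * (x j * y j)) * G - sumℚ {k} (λ _ → ℕ→ℚ 2 * ε * T * E)
        ≡⟨ cong (_- sumℚ {k} (λ _ → ℕ→ℚ 2 * ε * T * E)) (sumℚ-*ʳ G (λ j → T * (x j * y j))) ⟨
      sumℚ (λ j → T * (x j * y j) * G) - sumℚ {k} (λ _ → ℕ→ℚ 2 * ε * T * E)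
        ≡⟨ sumℚ-- (λ j → T * (x j * y j) * G) (λ _ → ℕ→ℚ 2 * ε * T * E) ⟨
      sumℚ (λ j → partTarget ε T E (x j) (y j)) ∎
      where
      open ≡-Reasoning
      c K S G : ℚ
      c = frac 1 (eSub H A₁ A₂ full full)
      K = ℕ→ℚ k
      S = sumℚ (λ j → x j * y j)
      G = E - ℕ→ℚ 2 * ε * (T * T)
      E*c≡1 : E * c ≡ 1ℚ
      E*c≡1 = trans (*-comm E c) (frac-*-cancel 1 (eSub H A₁ A₂ full full))
      expand : ∀ E T c S K ε two →
        E * (T * (1ℚ - two * ε * (T * T) * c) * S - two * ε * (K * T))
          ≡ T * S * (E - two * ε * (T * T) * (E * c)) - K * (two * ε * T * E)
      expand = solve-∀ ℚ-ring

    edgeSum-const : ∀ r → edgeSum (λ _ _ → r) ≡ E * r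
    edgeSum-const r = begin
      sumℚ (λ u → sumℚ (λ v → 𝟙 (edge u v) * r))   ≡⟨ sumℚ-cong (λ u → sumℚ-*ʳ r (λ v → 𝟙 (edge u v))) ⟩
      sumℚ (λ u → sumℚ (λ v → 𝟙 (edge u v)) * r)   ≡⟨ sumℚ-*ʳ r (λ u → sumℚ (λ v → 𝟙 (edge u v))) ⟩
      sumℚ (λ u → sumℚ (λ v → 𝟙 (edge u v))) * r   ≡⟨ cong (_* r) (sumℚ-cong (λ u → ℕ→ℚ-count (edge u))) ⟨
      sumℚ (λ u → ℕ→ℚ (count (edge u))) * r        ≡⟨ cong (_* r) E≡edgeCount ⟨
      E * r                                        ∎
      where open ≡-Reasoning

    average-bound : ∀ {x y : Fin k → ℚ} .{{_ : ℕ.NonZero (eSub H A₁ A₂ full full)}} →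
      (∀ j → Uniform ε H A₁ (B j)) → (∀ j → Uniform ε H A₂ (B j)) →
      (∀ j → x j * ℕ→ℚ (t ℕ.* t) ≤ ℕ→ℚ (eSub H A₁ (B j) full full)) →
      (∀ j → y j * ℕ→ℚ (t ℕ.* t) ≤ ℕ→ℚ (eSub H A₂ (B j) full full)) →
      (∀ j → 0ℚ ≤ x j) → (∀ j → 0ℚ ≤ y j) →
      edgeSum (λ _ _ → bound x y) ≤ edgeSum (λ u v → ℕ→ℚ (commonNbrs H (A₁ , u) (A₂ , v)))
    average-bound {x} {y} uniform₁ uniform₂ x≤e₁ y≤e₂ 0≤x 0≤y = begin
      edgeSum (λ _ _ → bound x y)
        ≡⟨ trans (edgeSum-const (bound x y)) (E*bound x y) ⟩
      sumℚ (λ j → partTarget ε T E (x j) (y j))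
        ≤⟨ sumℚ-mono-≤ (λ j → part-bound j (uniform₁ j) (uniform₂ j) (x≤e₁ j) (y≤e₂ j) (0≤x j) (0≤y j)) ⟩
      sumℚ (λ j → edgeSum (λ u v → ℕ→ℚ (codegree j u v)))
        ≡⟨ sumℚ-weighted-swap (λ u v → 𝟙 (edge u v)) (λ j u v → ℕ→ℚ (codegree j u v)) ⟩
      edgeSum (λ u v → sumℚ (λ j → ℕ→ℚ (codegree j u v)))
        ≤⟨ sumℚ-mono-≤ (λ u → sumℚ-mono-≤ (λ v → *-monoˡ-≤-nonNeg (𝟙 (edge u v)) {{nonNegative (0≤𝟙 (edge u v))}}
             (subst (_≤ ℕ→ℚ (commonNbrs H (A₁ , u) (A₂ , v))) (ℕ→ℚ-sumFin (λ j → codegree j u v))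
               (ℕ→ℚ-mono-≤ (codegrees≤commonNbrs u v))))) ⟩
      edgeSum (λ u v → ℕ→ℚ (commonNbrs H (A₁ , u) (A₂ , v))) ∎
      where open ≤-Reasoning

    ∃edge : 0 ℕ.< eSub H A₁ A₂ full full → ∃ λ u → ∃ λ v → edge u v ≡ true
    ∃edge 0<e = let u , 0<deg = sumFin-pos (λ u → count (edge u)) 0<e in u , count-pos (edge u) 0<deg

open import Defs
open import Data.Nat using (ℕ; suc; _≥_; _>_; _*_)
open import Data.Fin using (Fin; zero; suc; _↑ˡ_; _↑ʳ_)
open import Data.Bool using (true)
open import Data.Product using (Σ; _×_; _,_)
open import Data.Rational using (ℚ; 0ℚ; 1ℚ; _≤_; _<_; _+_; _-_)
open import Relation.Binary.PropositionalEquality using (_≡_)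
open import Data.Nat.Base using (NonZero; >-nonZero)
open BookCounting using (∃-above-average; module Parts)

corollary2 : (ε : ℚ) → 0ℚ < ε → (k t : ℕ) → k ≥ 1 → t ≥ 1 →
  (H : SimpleGraph (Vtx (2 Data.Nat.+ k) t)) →
  (d : Fin 2 → Fin k → ℚ) → (∀ i j → 0ℚ ≤ d i j) →
  (∀ (i : Fin 2) (j : Fin k) → Uniform ε H (i ↑ˡ k) (2 ↑ʳ j)) →
  (∀ (i : Fin 2) (j : Fin k) →
    d i j Data.Rational.* ℕ→ℚ (t * t) ≤ ℕ→ℚ (eSub H (i ↑ˡ k) (2 ↑ʳ j) full full)) →
  eSub H zero (suc zero) full full > 0 →
  Σ (Fin t) λ u → Σ (Fin t) λ v →
    (adj H (zero , u) (suc zero , v) ≡ true) ×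
    (ℕ→ℚ t Data.Rational.* (1ℚ - ℕ→ℚ 2 Data.Rational.* ε Data.Rational.* ℕ→ℚ (t * t) Data.Rational.* frac 1 (eSub H zero (suc zero) full full))
        Data.Rational.* sumℚ (λ j → d zero j Data.Rational.* d (suc zero) j)
      - ℕ→ℚ 2 Data.Rational.* ε Data.Rational.* ℕ→ℚ (k * t)
      ≤ ℕ→ℚ (commonNbrs H (zero , u) (suc zero , v)))
corollary2 ε 0<ε k t _ t≥1 H d 0≤d uniform d≤e e>0 =
  ∃-above-average edge (λ u v → ℕ→ℚ (commonNbrs H (A₁ , u) (A₂ , v))) (bound (d zero) (d (suc zero)))
    (∃edge e>0)
    (average-bound (uniform zero) (uniform (suc zero)) (d≤e zero) (d≤e (suc zero)) (0≤d zero) (0≤d (suc zero)))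
  where
  instance
    t≢0 : NonZero t
    t≢0 = >-nonZero t≥1
    e≢0 : NonZero (eSub H zero (suc zero) full full)
    e≢0 = >-nonZero e>0
  open Parts H 0<ε
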